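{- Let $d\geq 1$ and let $I=\{i_1,\ldots,i_d\}$, $J=\{j_1,\ldots,j_d\}$ with $0\leq i_1<\cdots<i_d$ and $0\leq j_1<\cdots<j_d$ integers. (a) If $J\not\leq I$, then $b^I_J=0$. (b) If $J=I$, then $b^I_J=1$. (c) If $J\leq I$, then $b^I_J=\pi^I_J\cdot b^{I-j_1}_{J-j_1}$.
   Context: For integers $p,q\geq 0$, $b_{p,q}=\binom{p}{q}$, with $b_{p,q}=0$ if $q>p$. For finite sets $I=\{i_1<\cdots<i_d\}$ and $J=\{j_1<\cdots<j_d\}$ of non-negative integers, $b^I_J$ denotes the determinant of the $d\times d$ matrix whose $(r,s)$ entry is $b_{i_r,j_s}$. We write $J\leq I$ if $j_k\leq i_k$ for all $k=1,\ldots,d$. When $J\leq I$, $\pi^I_J$ is the rational number $\pi^I_J=\frac{b_{i_1,j_1}\cdots b_{i_d,j_1}}{b_{j_1,j_1}\cdots b_{j_d,j_1}}$. For $p\leq i_1$, $I-p=\{i_1-p,\ldots,i_d-p\}$. -}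

module Defs where

open import Data.Nat using (ℕ; zero; suc; _∸_) renaming (_≤_ to _≤ℕ_; _<_ to _<ℕ_; _*_ to _*ℕ_)
open import Data.Nat.Combinatorics using (_C_)
open import Data.Fin using (Fin; zero; suc; punchIn) renaming (_<_ to _<F_)
open import Data.Integer using (ℤ; +_) renaming (_-_ to _-ℤ_; _*_ to _*ℤ_)
open import Data.Rational using (ℚ; _/_; 0ℚ)

-- b_{p,q} = binom(p,q); stdlib's _C_ is 0 when q > p.
b : ℕ → ℕ → ℕ
b p q = p C q

-- A finite set {i_1 < ... < i_d} is given by the increasing
-- enumeration r ↦ i_{r+1}, r : Fin d.
StrictlyIncreasing : ∀ {d} → (Fin d → ℕ) → Set
StrictlyIncreasing {d} I = ∀ (r s : Fin d) → r <F s → I r <ℕ I s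

_≼_ : ∀ {d} → (Fin d → ℕ) → (Fin d → ℕ) → Set
_≼_ {d} J I = ∀ (k : Fin d) → J k ≤ℕ I k

-- Determinant over ℤ by Laplace expansion along the first row.
-- altSum f = f 0 - f 1 + f 2 - ... = Σ_s (-1)^s f s
altSum : ∀ n → (Fin n → ℤ) → ℤ
altSum zero    f = + 0
altSum (suc n) f = f zero -ℤ altSum n (λ s → f (suc s))

det : ∀ n → (Fin n → Fin n → ℤ) → ℤ
det zero    M = + 1
det (suc n) M = altSum (suc n) (λ s → M zero s *ℤ det n (λ r c → M (suc r) (punchIn s c)))

bdet : ∀ {d} → (Fin d → ℕ) → (Fin d → ℕ) → ℤ
bdet {d} I J = det d (λ r s → + b (I r) (J s))

prod : ∀ n → (Fin n → ℕ) → ℕ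
prod zero    f = 1
prod (suc n) f = f zero *ℕ prod n (λ k → f (suc k))

-- I - p = {i_1 - p, ..., i_d - p}   (used only when p ≤ i_1)
shift : ∀ {d} → (Fin d → ℕ) → ℕ → (Fin d → ℕ)
shift I p k = I k ∸ p

-- the rational number m / n; the n = 0 branch is never used below
-- (denominators b_{j_k,j_1} are ≥ 1 since j_1 ≤ j_k).
ratio : ℕ → ℕ → ℚ
ratio m zero    = 0ℚ
ratio m (suc n) = (+ m) / suc n

π : ∀ {n} → (Fin (suc n) → ℕ) → (Fin (suc n) → ℕ) → ℚ
π {n} I J = ratio (prod (suc n) (λ k → b (I k) (J zero))) (prod (suc n) (λ k → b (J k) (J zero)))

{-# OPTIONS --safe #-}
module Submission where

-- For a ≤ j, the identity b(i,j) b(j,a) = b(i,a) b(i-a,j-a) says that multiplying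
-- column s of (b(i_r,j_s)) by b(j_s,j_1) and row r by b(i_r,j_1) yields
-- (b(i_r-j_1, j_s-j_1)); comparing determinants gives (c). If j_k > i_k, then
-- b(i_r,j_s) = 0 whenever r ≤ k ≤ s, because i_r ≤ i_k < j_k ≤ j_s; such a
-- (k+1) × (d-k) zero block forces the determinant to vanish. For J = I the
-- matrix is lower unitriangular.

module BinomialIdentities where
  open import Data.Nat
  open import Data.Nat.Properties
  open import Data.Nat.Combinatorics
  open import Data.Nat.DivMod using (m/n*n≡m)
  open import Data.Nat.Tactic.RingSolver using (solve-∀)
  open import Relation.Binary.PropositionalEquality
  open import Relation.Nullary.Decidable using (yes; no)

  nCk*[k!*[n∸k]!]≡n! : ∀ {n k} → k ≤ n → (n C k) * (k ! * (n ∸ k) !) ≡ n !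
  nCk*[k!*[n∸k]!]≡n! {n} {k} k≤n = begin
    (n C k) * (k ! * (n ∸ k) !)             ≡⟨ cong (_* (k ! * (n ∸ k) !)) (nCk≡n!/k![n-k]! k≤n) ⟩
    (n ! / (k ! * (n ∸ k) !)) * (k ! * (n ∸ k) !) ≡⟨ m/n*n≡m (k![n∸k]!∣n! k≤n) ⟩
    n !                                     ∎
    where
    open ≡-Reasoning
    instance
      k!*[n∸k]!≢0 : NonZero (k ! * (n ∸ k) !)
      k!*[n∸k]!≢0 = k !* (n ∸ k) !≢0

  nCk≢0 : ∀ {n k} → k ≤ n → NonZero (n C k)
  nCk≢0 {n} {k} k≤n = m*n≢0⇒m≢0 (n C k) {{subst NonZero (sym (nCk*[k!*[n∸k]!]≡n! k≤n)) (n !≢0)}}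

  [n∸j]∸[k∸j]≡n∸k : ∀ n {k j} → j ≤ k → (n ∸ j) ∸ (k ∸ j) ≡ n ∸ k
  [n∸j]∸[k∸j]≡n∸k n {k} {j} j≤k = trans (∸-+-assoc n j (k ∸ j)) (cong (n ∸_) (m+[n∸m]≡n j≤k))

  -- Both sides times j! (k ∸ j)! (n ∸ k)! equal n!.
  nCk*kCj≡nCj*[n∸j]C[k∸j]-≤ : ∀ {n k j} → j ≤ k → k ≤ n →
                              (n C k) * (k C j) ≡ (n C j) * ((n ∸ j) C (k ∸ j))
  nCk*kCj≡nCj*[n∸j]C[k∸j]-≤ {n} {k} {j} j≤k k≤n =
    *-cancelʳ-≡ _ _ (j ! * ((k ∸ j) ! * (n ∸ k) !)) {{m*n≢0 _ _ {{j !≢0}} {{(k ∸ j) !* (n ∸ k) !≢0}}}}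
      (trans lhs (sym rhs))
    where
    open ≡-Reasoning
    shuffleˡ : ∀ x y p q r → x * y * (p * (q * r)) ≡ x * (y * (p * q)) * r
    shuffleˡ = solve-∀
    shuffleʳ : ∀ x y p q r → x * y * (p * (q * r)) ≡ x * (p * (y * (q * r)))
    shuffleʳ = solve-∀
    lhs : (n C k) * (k C j) * (j ! * ((k ∸ j) ! * (n ∸ k) !)) ≡ n !
    lhs = begin
      (n C k) * (k C j) * (j ! * ((k ∸ j) ! * (n ∸ k) !))
        ≡⟨ shuffleˡ (n C k) (k C j) (j !) ((k ∸ j) !) ((n ∸ k) !) ⟩
      (n C k) * ((k C j) * (j ! * (k ∸ j) !)) * (n ∸ k) !
        ≡⟨ cong (λ z → (n C k) * z * (n ∸ k) !) (nCk*[k!*[n∸k]!]≡n! j≤k) ⟩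
      (n C k) * k ! * (n ∸ k) !
        ≡⟨ *-assoc (n C k) (k !) ((n ∸ k) !) ⟩
      (n C k) * (k ! * (n ∸ k) !)
        ≡⟨ nCk*[k!*[n∸k]!]≡n! k≤n ⟩
      n !
        ∎
    rhs : (n C j) * ((n ∸ j) C (k ∸ j)) * (j ! * ((k ∸ j) ! * (n ∸ k) !)) ≡ n !
    rhs = begin
      (n C j) * ((n ∸ j) C (k ∸ j)) * (j ! * ((k ∸ j) ! * (n ∸ k) !))
        ≡⟨ shuffleʳ (n C j) ((n ∸ j) C (k ∸ j)) (j !) ((k ∸ j) !) ((n ∸ k) !) ⟩
      (n C j) * (j ! * (((n ∸ j) C (k ∸ j)) * ((k ∸ j) ! * (n ∸ k) !)))
        ≡⟨ cong (λ z → (n C j) * (j ! * (((n ∸ j) C (k ∸ j)) * ((k ∸ j) ! * z !)))) (sym ([n∸j]∸[k∸j]≡n∸k n j≤k)) ⟩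
      (n C j) * (j ! * (((n ∸ j) C (k ∸ j)) * ((k ∸ j) ! * ((n ∸ j) ∸ (k ∸ j)) !)))
        ≡⟨ cong (λ z → (n C j) * (j ! * z)) (nCk*[k!*[n∸k]!]≡n! (∸-monoˡ-≤ j k≤n)) ⟩
      (n C j) * (j ! * (n ∸ j) !)
        ≡⟨ nCk*[k!*[n∸k]!]≡n! (≤-trans j≤k k≤n) ⟩
      n !
        ∎

  nCk*kCj≡nCj*[n∸j]C[k∸j] : ∀ n k j → j ≤ k → (n C k) * (k C j) ≡ (n C j) * ((n ∸ j) C (k ∸ j))
  nCk*kCj≡nCj*[n∸j]C[k∸j] n k j j≤k with k ≤? n | j ≤? n
  ... | yes k≤n | _       = nCk*kCj≡nCj*[n∸j]C[k∸j]-≤ j≤k k≤n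
  ... | no k≰n  | yes j≤n = begin
    (n C k) * (k C j)             ≡⟨ cong (_* (k C j)) (k>n⇒nCk≡0 (≰⇒> k≰n)) ⟩
    0                             ≡⟨ sym (*-zeroʳ (n C j)) ⟩
    (n C j) * 0                   ≡⟨ cong ((n C j) *_) (sym (k>n⇒nCk≡0 (∸-monoˡ-< (≰⇒> k≰n) j≤n))) ⟩
    (n C j) * ((n ∸ j) C (k ∸ j)) ∎
    where open ≡-Reasoning
  ... | no k≰n  | no j≰n  = begin
    (n C k) * (k C j)             ≡⟨ cong (_* (k C j)) (k>n⇒nCk≡0 (≰⇒> k≰n)) ⟩
    0                             ≡⟨ cong (_* ((n ∸ j) C (k ∸ j))) (sym (k>n⇒nCk≡0 (≰⇒> j≰n))) ⟩
    (n C j) * ((n ∸ j) C (k ∸ j)) ∎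
    where open ≡-Reasoning

module Determinants where
  open import Defs
  open import Data.Nat as ℕ using (ℕ; zero; suc; z≤n; s≤s)
  import Data.Nat.Properties as ℕ
  open import Data.Fin using (Fin; zero; suc; punchIn; _≤_; _<_; _≤?_)
  open import Data.Integer using (ℤ; 0ℤ; 1ℤ; +_; _*_; _-_)
  open import Data.Integer.Properties using (*-zeroʳ; *-comm; pos-*; *-commutativeSemigroup)
  open import Algebra.Properties.CommutativeSemigroup *-commutativeSemigroup using (interchange)
  open import Data.Integer.Tactic.RingSolver using (solve-∀)
  open import Algebra.Properties.CommutativeSemigroup ℕ.*-commutativeSemigroup using (x∙yz≈y∙xz)
  open import Relation.Binary.PropositionalEquality
  open import Relation.Nullary.Decidable using (yes; no)

  private variable
    n : ℕ

  altSum-cong : ∀ n {f g : Fin n → ℤ} → (∀ s → f s ≡ g s) → altSum n f ≡ altSum n g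
  altSum-cong zero    f≡g = refl
  altSum-cong (suc n) f≡g = cong₂ _-_ (f≡g zero) (altSum-cong n (λ s → f≡g (suc s)))

  altSum-*ˡ : ∀ n a (f : Fin n → ℤ) → altSum n (λ s → a * f s) ≡ a * altSum n f
  altSum-*ˡ zero    a f = sym (*-zeroʳ a)
  altSum-*ˡ (suc n) a f = trans (cong (a * f zero -_) (altSum-*ˡ n a (λ s → f (suc s))))
                                (*-distribˡ-minus a (f zero) (altSum n (λ s → f (suc s))))
    where
    *-distribˡ-minus : ∀ a x y → a * x - a * y ≡ a * (x - y)
    *-distribˡ-minus = solve-∀

  altSum-0 : ∀ n (f : Fin n → ℤ) → (∀ s → f s ≡ 0ℤ) → altSum n f ≡ 0ℤ
  altSum-0 zero    f f≡0 = refl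
  altSum-0 (suc n) f f≡0 = cong₂ _-_ (f≡0 zero) (altSum-0 n (λ s → f (suc s)) (λ s → f≡0 (suc s)))

  minor : (Fin (suc n) → Fin (suc n) → ℤ) → Fin (suc n) → Fin n → Fin n → ℤ
  minor M s r c = M (suc r) (punchIn s c)

  det-cong : ∀ n {M N : Fin n → Fin n → ℤ} → (∀ r s → M r s ≡ N r s) → det n M ≡ det n N
  det-cong zero    M≡N = refl
  det-cong (suc n) M≡N = altSum-cong (suc n) λ s →
    cong₂ _*_ (M≡N zero s) (det-cong n (λ r c → M≡N (suc r) (punchIn s c)))

  prod-punchIn : ∀ n (f : Fin (suc n) → ℕ) s → prod (suc n) f ≡ f s ℕ.* prod n (λ k → f (punchIn s k))
  prod-punchIn n       f zero    = refl
  prod-punchIn (suc n) f (suc s) = trans (cong (f zero ℕ.*_) (prod-punchIn n (λ k → f (suc k)) s))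
                                         (x∙yz≈y∙xz (f zero) (f (suc s)) _)

  det-scaleRows : ∀ n (f : Fin n → ℕ) (M : Fin n → Fin n → ℤ) →
                  det n (λ r s → + f r * M r s) ≡ + prod n f * det n M
  det-scaleRows zero    f M = refl
  det-scaleRows (suc n) f M = begin
    altSum (suc n) (λ s → (+ f zero * M zero s) * det n (λ r c → + f (suc r) * minor M s r c))
      ≡⟨ altSum-cong (suc n) (λ s → cong ((+ f zero * M zero s) *_) (det-scaleRows n (λ r → f (suc r)) (minor M s))) ⟩
    altSum (suc n) (λ s → (+ f zero * M zero s) * (+ p * det n (minor M s)))
      ≡⟨ altSum-cong (suc n) (λ s → interchange (+ f zero) (M zero s) (+ p) (det n (minor M s))) ⟩
    altSum (suc n) (λ s → (+ f zero * + p) * (M zero s * det n (minor M s)))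
      ≡⟨ altSum-*ˡ (suc n) (+ f zero * + p) (λ s → M zero s * det n (minor M s)) ⟩
    (+ f zero * + p) * det (suc n) M
      ≡⟨ cong (_* det (suc n) M) (sym (pos-* (f zero) p)) ⟩
    + prod (suc n) f * det (suc n) M
      ∎
    where
    open ≡-Reasoning
    p : ℕ
    p = prod n (λ r → f (suc r))

  det-scaleCols : ∀ n (f : Fin n → ℕ) (M : Fin n → Fin n → ℤ) →
                  det n (λ r s → M r s * + f s) ≡ + prod n f * det n M
  det-scaleCols zero    f M = refl
  det-scaleCols (suc n) f M = trans (altSum-cong (suc n) term)
    (altSum-*ˡ (suc n) (+ prod (suc n) f) (λ s → M zero s * det n (minor M s)))
    where
    term : ∀ s → (M zero s * + f s) * det n (λ r c → minor M s r c * + f (punchIn s c))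
               ≡ + prod (suc n) f * (M zero s * det n (minor M s))
    term s = begin
      (M zero s * + f s) * det n (λ r c → minor M s r c * + f (punchIn s c))
        ≡⟨ cong ((M zero s * + f s) *_) (det-scaleCols n (λ c → f (punchIn s c)) (minor M s)) ⟩
      (M zero s * + f s) * (+ p * d)
        ≡⟨ cong (_* (+ p * d)) (*-comm (M zero s) (+ f s)) ⟩
      (+ f s * M zero s) * (+ p * d)
        ≡⟨ interchange (+ f s) (M zero s) (+ p) d ⟩
      (+ f s * + p) * (M zero s * d)
        ≡⟨ cong (_* (M zero s * d)) (sym (pos-* (f s) p)) ⟩
      + (f s ℕ.* p) * (M zero s * d)
        ≡⟨ cong (λ q → + q * (M zero s * d)) (sym (prod-punchIn n f s)) ⟩
      + prod (suc n) f * (M zero s * d)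
        ∎
      where
      open ≡-Reasoning
      p : ℕ
      p = prod n (λ c → f (punchIn s c))
      d : ℤ
      d = det n (minor M s)

  punchIn-≥ : ∀ (i : Fin (suc n)) (j : Fin n) → i ≤ j → punchIn i j ≡ suc j
  punchIn-≥ zero    j       _         = refl
  punchIn-≥ (suc i) (suc j) (s≤s i≤j) = cong suc (punchIn-≥ i j i≤j)

  -- Expanding along row 0, each term either has its entry in the zero block or
  -- its minor contains a zero block with one row and column fewer.
  det-zeroBlock : ∀ n (M : Fin (suc n) → Fin (suc n) → ℤ) (k : Fin (suc n)) →
                  (∀ r s → r ≤ k → k ≤ s → M r s ≡ 0ℤ) → det (suc n) M ≡ 0ℤ
  det-zeroBlock n M zero M≡0 = altSum-0 (suc n) _ λ s →
    cong (_* det n (minor M s)) (M≡0 zero s z≤n z≤n)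
  det-zeroBlock (suc n) M (suc k) M≡0 = altSum-0 (suc (suc n)) _ term
    where
    term : ∀ s → M zero s * det (suc n) (minor M s) ≡ 0ℤ
    term s with suc k ≤? s
    ... | yes k<s = cong (_* det (suc n) (minor M s)) (M≡0 zero s z≤n k<s)
    ... | no  k≮s = trans (cong (M zero s *_) (det-zeroBlock n (minor M s) k minor≡0)) (*-zeroʳ (M zero s))
      where
      s≤k : s ≤ k
      s≤k = ℕ.s≤s⁻¹ (ℕ.≰⇒> k≮s)
      minor≡0 : ∀ r c → r ≤ k → k ≤ c → minor M s r c ≡ 0ℤ
      minor≡0 r c r≤k k≤c rewrite punchIn-≥ s c (ℕ.≤-trans s≤k k≤c) = M≡0 (suc r) (suc c) (s≤s r≤k) (s≤s k≤c)

  det-lowerUnitriangular : ∀ n (M : Fin n → Fin n → ℤ) →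
                           (∀ r s → r < s → M r s ≡ 0ℤ) → (∀ r → M r r ≡ 1ℤ) → det n M ≡ 1ℤ
  det-lowerUnitriangular zero    M upper≡0 diag≡1 = refl
  det-lowerUnitriangular (suc n) M upper≡0 diag≡1 = cong₂ _-_ leading rest
    where
    leading : M zero zero * det n (minor M zero) ≡ 1ℤ
    leading = cong₂ _*_ (diag≡1 zero)
      (det-lowerUnitriangular n (minor M zero) (λ r s r<s → upper≡0 (suc r) (suc s) (s≤s r<s)) (λ r → diag≡1 (suc r)))
    rest : altSum n (λ s → M zero (suc s) * det n (minor M (suc s))) ≡ 0ℤ
    rest = altSum-0 n _ λ s → cong (_* det n (minor M (suc s))) (upper≡0 zero (suc s) (s≤s z≤n))

open import Defs
open import Data.Nat using (ℕ; suc)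
open import Data.Fin using (Fin; zero)
open import Data.Integer using (+_)
open import Data.Rational using (_*_; _/_)
open import Data.Product using (_×_)
open import Relation.Nullary using (¬_)
open import Relation.Binary.PropositionalEquality using (_≡_)

open import Data.Product using (_,_)
import Data.Nat as ℕ
import Data.Nat.Properties as ℕ
open import Data.Nat.Combinatorics using (_C_; k>n⇒nCk≡0; nCn≡1)
import Data.Fin as Fin
open import Data.Fin.Properties using (_≟_; ≤∧≢⇒<; ¬∀⟶∃¬)
open import Data.Integer as ℤ using (ℤ; 0ℤ; 1ℤ)
import Data.Integer.Properties as ℤ
open import Data.Rational using (toℚᵘ)
open import Data.Rational.Properties using (toℚᵘ-injective; toℚᵘ-homo-*; toℚᵘ-fromℚᵘ)
import Data.Rational.Unnormalised as ℚᵘ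
import Data.Rational.Unnormalised.Properties as ℚᵘ
open import Relation.Nullary.Decidable using (yes; no)
open import Relation.Binary.PropositionalEquality using (refl; sym; trans; cong; module ≡-Reasoning)

open BinomialIdentities using (nCk≢0; nCk*kCj≡nCj*[n∸j]C[k∸j])
open Determinants using (det-cong; det-scaleRows; det-scaleCols; det-zeroBlock; det-lowerUnitriangular)

prod-≢0 : ∀ n (f : Fin n → ℕ) → (∀ k → ℕ.NonZero (f k)) → ℕ.NonZero (prod n f)
prod-≢0 ℕ.zero  f f≢0 = _
prod-≢0 (suc n) f f≢0 =
  ℕ.m*n≢0 (f zero) _ {{f≢0 zero}} {{prod-≢0 n (λ k → f (Fin.suc k)) (λ k → f≢0 (Fin.suc k))}}

-- x / n unfolds to fromℚᵘ (mkℚᵘ x (n ∸ 1)), so the equation can be checked in ℚᵘ.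
/1≡ratio*/1 : ∀ (x y : ℤ) p q .{{_ : ℕ.NonZero q}} →
              x ℤ.* + q ≡ + p ℤ.* y → x / 1 ≡ ratio p q * (y / 1)
/1≡ratio*/1 x y p (suc q) cross = toℚᵘ-injective (begin
  toℚᵘ (x / 1)                          ≈⟨ toℚᵘ-fromℚᵘ (ℚᵘ.mkℚᵘ x 0) ⟩
  ℚᵘ.mkℚᵘ x 0                           ≈⟨ ℚᵘ.*≡* (trans cross′ (sym (ℤ.*-identityʳ (+ p ℤ.* y)))) ⟩
  ℚᵘ.mkℚᵘ (+ p) q ℚᵘ.* ℚᵘ.mkℚᵘ y 0      ≈⟨ ℚᵘ.*-cong (toℚᵘ-fromℚᵘ (ℚᵘ.mkℚᵘ (+ p) q)) (toℚᵘ-fromℚᵘ (ℚᵘ.mkℚᵘ y 0)) ⟨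
  toℚᵘ (+ p / suc q) ℚᵘ.* toℚᵘ (y / 1)  ≈⟨ toℚᵘ-homo-* (+ p / suc q) (y / 1) ⟨
  toℚᵘ ((+ p / suc q) * (y / 1))        ∎)
  where
  open ℚᵘ.≃-Reasoning
  cross′ : x ℤ.* + (suc q ℕ.* 1) ≡ + p ℤ.* y
  cross′ = trans (cong (λ d → x ℤ.* + d) (ℕ.*-identityʳ (suc q))) cross

strictlyIncreasing⇒monotone : ∀ {d} {I : Fin d → ℕ} → StrictlyIncreasing I →
                              ∀ {r s} → r Fin.≤ s → I r ℕ.≤ I s
strictlyIncreasing⇒monotone I↑ {r} {s} r≤s with r ≟ s
... | yes refl = ℕ.≤-refl
... | no  r≢s  = ℕ.<⇒≤ (I↑ r s (≤∧≢⇒< r≤s r≢s))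

iₖ<jₖ⇒bdet≡0 : ∀ {n} {I J : Fin (suc n) → ℕ} → StrictlyIncreasing I → StrictlyIncreasing J →
               ∀ k → I k ℕ.< J k → bdet I J ≡ 0ℤ
iₖ<jₖ⇒bdet≡0 {n} {I} {J} I↑ J↑ k iₖ<jₖ = det-zeroBlock n _ k λ r s r≤k k≤s →
  cong +_ (k>n⇒nCk≡0 (begin-strict
    I r  ≤⟨ strictlyIncreasing⇒monotone I↑ r≤k ⟩
    I k  <⟨ iₖ<jₖ ⟩
    J k  ≤⟨ strictlyIncreasing⇒monotone J↑ k≤s ⟩
    J s  ∎))
  where open ℕ.≤-Reasoning

bdet[I,I]≡1 : ∀ {d} {I : Fin d → ℕ} → StrictlyIncreasing I → bdet I I ≡ 1ℤ
bdet[I,I]≡1 {d} {I} I↑ = det-lowerUnitriangular d _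
  (λ r s r<s → cong +_ (k>n⇒nCk≡0 (I↑ r s r<s)))
  (λ r → cong +_ (nCn≡1 (I r)))

bdet-shift : ∀ d (I J : Fin d → ℕ) a → (∀ s → a ℕ.≤ J s) →
             + prod d (λ s → b (J s) a) ℤ.* bdet I J
               ≡ + prod d (λ r → b (I r) a) ℤ.* bdet (shift I a) (shift J a)
bdet-shift d I J a a≤J = begin
  + prod d (λ s → b (J s) a) ℤ.* bdet I J
    ≡⟨ sym (det-scaleCols d (λ s → b (J s) a) (λ r s → + b (I r) (J s))) ⟩
  det d (λ r s → + b (I r) (J s) ℤ.* + b (J s) a)
    ≡⟨ det-cong d entry ⟩
  det d (λ r s → + b (I r) a ℤ.* + b (I r ℕ.∸ a) (J s ℕ.∸ a))
    ≡⟨ det-scaleRows d (λ r → b (I r) a) (λ r s → + b (I r ℕ.∸ a) (J s ℕ.∸ a)) ⟩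
  + prod d (λ r → b (I r) a) ℤ.* bdet (shift I a) (shift J a)
    ∎
  where
  open ≡-Reasoning
  entry : ∀ r s → + b (I r) (J s) ℤ.* + b (J s) a ≡ + b (I r) a ℤ.* + b (I r ℕ.∸ a) (J s ℕ.∸ a)
  entry r s = begin
    + b (I r) (J s) ℤ.* + b (J s) a               ≡⟨ ℤ.pos-* (b (I r) (J s)) (b (J s) a) ⟨
    + (b (I r) (J s) ℕ.* b (J s) a)               ≡⟨ cong +_ (nCk*kCj≡nCj*[n∸j]C[k∸j] (I r) (J s) a (a≤J s)) ⟩
    + (b (I r) a ℕ.* b (I r ℕ.∸ a) (J s ℕ.∸ a))   ≡⟨ ℤ.pos-* (b (I r) a) (b (I r ℕ.∸ a) (J s ℕ.∸ a)) ⟩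
    + b (I r) a ℤ.* + b (I r ℕ.∸ a) (J s ℕ.∸ a)   ∎

lemma2p2 : (n : ℕ) (I J : Fin (suc n) → ℕ)
    → StrictlyIncreasing I → StrictlyIncreasing J
    → (¬ (J ≼ I) → bdet I J ≡ + 0)
      × ((∀ k → J k ≡ I k) → bdet I J ≡ + 1)
      × (J ≼ I → (bdet I J / 1) ≡ π I J * (bdet (shift I (J zero)) (shift J (J zero)) / 1))
lemma2p2 n I J I↑ J↑ = vanishes , unit , factorises
  where
  vanishes : ¬ (J ≼ I) → bdet I J ≡ + 0
  vanishes J⋠I with ¬∀⟶∃¬ (suc n) _ (λ k → J k ℕ.≤? I k) J⋠I
  ... | k , jₖ≰iₖ = iₖ<jₖ⇒bdet≡0 I↑ J↑ k (ℕ.≰⇒> jₖ≰iₖ)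

  unit : (∀ k → J k ≡ I k) → bdet I J ≡ + 1
  unit J≡I = trans (det-cong (suc n) (λ r s → cong (λ j → + b (I r) j) (J≡I s))) (bdet[I,I]≡1 I↑)

  j₁≤J : ∀ s → J zero ℕ.≤ J s
  j₁≤J s = strictlyIncreasing⇒monotone J↑ ℕ.z≤n

  -- The identity holds without J ≼ I.
  factorises : J ≼ I → (bdet I J / 1) ≡ π I J * (bdet (shift I (J zero)) (shift J (J zero)) / 1)
  factorises _ = /1≡ratio*/1 (bdet I J) (bdet (shift I (J zero)) (shift J (J zero))) _ denominator
    {{prod-≢0 (suc n) (λ s → b (J s) (J zero)) (λ s → nCk≢0 (j₁≤J s))}}
    (trans (ℤ.*-comm (bdet I J) (+ denominator)) (bdet-shift (suc n) I J (J zero) j₁≤J))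
    where
    denominator : ℕ
    denominator = prod (suc n) (λ s → b (J s) (J zero))
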